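{- Let $G$ be a (claw, co-claw)-free graph. Then at least one of the following holds: (i) $G$ or $\overline{G}$ contains no triangle; (ii) $G$ or $\overline{G}$ is the net; (iii) $G$ or $\overline{G}$ belongs to $\mathcal{F}_1$; (iv) $G$ or $\overline{G}$ belongs to $\mathcal{F}_2$.
   Context: Graphs are finite and simple; $\overline{G}$ is the complement of $G$. The claw is $K_{1,3}$; the co-claw is its complement. $G$ is $H$-free if it contains no member of $H$ as an induced subgraph. The net: a triangle $c_1c_2c_3$ plus vertices $s_1,s_2,s_3$ with $s_i$ adjacent only to $c_i$. The antenna: vertices $a,b,c,d,e,f$ with edges $ab, bc, cd, da, eb, ec, fe$. The bull: a triangle with two pendant edges at two distinct triangle vertices. $F_1$: vertices $1,\dots,9$ with edges $12, 14, 23, 34, 25, 35, 56, 19, 49, 59, 69, 67, 27, 78, 17, 38, 48, 68$. $F_2$: vertices $c_1,c_2,c_3,s_1,s_2,x,y$ with edges $c_1c_2, c_1c_3, c_2c_3, s_1c_1, s_2c_2, xs_1, xc_1, xs_2, ys_1, yc_2, ys_2$. $\mathcal{F}_1$ is the class of graphs $G$ such that $G$ or $\overline{G}$ contains an induced antenna and is an induced subgraph of $F_1$; $\mathcal{F}_2$ is the class of graphs $G$ such that $G$ or $\overline{G}$ contains an induced bull and is an induced subgraph of $F_2$. -}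

module Defs where

open import Data.Nat using (ℕ)
open import Data.Fin using (Fin; zero; suc; #_; _≟_)
open import Data.Bool using (Bool; true; false; not; if_then_else_; _∨_; _∧_)
open import Data.List using (List; []; _∷_)
open import Data.Product using (Σ; _×_; _,_)
open import Data.Sum using (_⊎_)
open import Relation.Nullary using (¬_; does)
open import Relation.Binary.PropositionalEquality using (_≡_; refl; sym; cong; cong₂)
open import Function.Definitions using (Injective; Surjective)

record Graph : Set where
  field
    n      : ℕ
    adj    : Fin n → Fin n → Bool
    adjSym : ∀ i j → adj i j ≡ adj j i
    irrefl : ∀ i → adj i i ≡ false
open Graph public

private
  ≟-sym : ∀ {m} (i j : Fin m) → does (i ≟ j) ≡ does (j ≟ i)
  ≟-sym i j with i ≟ j | j ≟ i
  ... | Relation.Nullary.yes _ | Relation.Nullary.yes _ = refl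
  ... | Relation.Nullary.no _  | Relation.Nullary.no _  = refl
  ... | Relation.Nullary.yes p | Relation.Nullary.no q  = Data.Empty.⊥-elim (q (sym p))
    where import Data.Empty
  ... | Relation.Nullary.no q  | Relation.Nullary.yes p = Data.Empty.⊥-elim (q (sym p))
    where import Data.Empty

  ≟-refl : ∀ {m} (i : Fin m) → does (i ≟ i) ≡ true
  ≟-refl i with i ≟ i
  ... | Relation.Nullary.yes _ = refl
  ... | Relation.Nullary.no q  = Data.Empty.⊥-elim (q refl)
    where import Data.Empty

complement : Graph → Graph
complement G = record
  { n      = n G
  ; adj    = λ i j → if does (i ≟ j) then false else not (adj G i j)
  ; adjSym = λ i j → helper i j
  ; irrefl = λ i → irr i
  }
  where
  helper : ∀ i j → (if does (i ≟ j) then false else not (adj G i j))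
                 ≡ (if does (j ≟ i) then false else not (adj G j i))
  helper i j rewrite ≟-sym i j | adjSym G i j = refl
  irr : ∀ i → (if does (i ≟ i) then false else not (adj G i i)) ≡ false
  irr i rewrite ≟-refl i = refl

_≤ᵢ_ : Graph → Graph → Set
H ≤ᵢ G = Σ (Fin (n H) → Fin (n G)) λ f →
           Injective _≡_ _≡_ f × (∀ i j → adj G (f i) (f j) ≡ adj H i j)

Contains : Graph → Graph → Set
Contains G H = H ≤ᵢ G

Free : Graph → Graph → Set
Free H G = ¬ Contains G H

_≅_ : Graph → Graph → Set
G ≅ H = Σ (Fin (n G) → Fin (n H)) λ f →
          Injective _≡_ _≡_ f × Surjective _≡_ _≡_ f ×
          (∀ i j → adj H (f i) (f j) ≡ adj G i j)

private
  edgeIs : ∀ {m} → Fin m × Fin m → Fin m → Fin m → Bool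
  edgeIs (a , b) i j = (does (a ≟ i) ∧ does (b ≟ j)) ∨ (does (a ≟ j) ∧ does (b ≟ i))

  hasEdge : ∀ {m} → List (Fin m × Fin m) → Fin m → Fin m → Bool
  hasEdge [] i j = false
  hasEdge (e ∷ es) i j = edgeIs e i j ∨ hasEdge es i j

  ∨-comm : ∀ a b → (a ∨ b) ≡ (b ∨ a)
  ∨-comm false false = refl
  ∨-comm false true = refl
  ∨-comm true false = refl
  ∨-comm true true = refl

  hasEdge-sym : ∀ {m} (es : List (Fin m × Fin m)) i j → hasEdge es i j ≡ hasEdge es j i
  hasEdge-sym [] i j = refl
  hasEdge-sym ((a , b) ∷ es) i j =
    cong₂ _∨_ (∨-comm (does (a ≟ i) ∧ does (b ≟ j)) (does (a ≟ j) ∧ does (b ≟ i)))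
              (hasEdge-sym es i j)

fromEdges : (m : ℕ) → List (Fin m × Fin m) → Graph
fromEdges m es = record
  { n      = m
  ; adj    = λ i j → if does (i ≟ j) then false else hasEdge es i j
  ; adjSym = λ i j → h i j
  ; irrefl = λ i → r i
  }
  where
  h : ∀ i j → (if does (i ≟ j) then false else hasEdge es i j)
            ≡ (if does (j ≟ i) then false else hasEdge es j i)
  h i j rewrite ≟-sym i j | hasEdge-sym es i j = refl
  r : ∀ i → (if does (i ≟ i) then false else hasEdge es i i) ≡ false
  r i rewrite ≟-refl i = refl

triangle : Graph
triangle = fromEdges 3 ((# 0 , # 1) ∷ (# 1 , # 2) ∷ (# 0 , # 2) ∷ [])

claw : Graph
claw = fromEdges 4 ((# 0 , # 1) ∷ (# 0 , # 2) ∷ (# 0 , # 3) ∷ [])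

coClaw : Graph
coClaw = complement claw

-- net: c1 c2 c3 s1 s2 s3 = 0 1 2 3 4 5
net : Graph
net = fromEdges 6 ((# 0 , # 1) ∷ (# 1 , # 2) ∷ (# 0 , # 2) ∷
                   (# 3 , # 0) ∷ (# 4 , # 1) ∷ (# 5 , # 2) ∷ [])

-- antenna: a b c d e f = 0 1 2 3 4 5; edges ab bc cd da eb ec fe
antenna : Graph
antenna = fromEdges 6 ((# 0 , # 1) ∷ (# 1 , # 2) ∷ (# 2 , # 3) ∷ (# 3 , # 0) ∷
                       (# 4 , # 1) ∷ (# 4 , # 2) ∷ (# 5 , # 4) ∷ [])

bull : Graph
bull = fromEdges 5 ((# 0 , # 1) ∷ (# 1 , # 2) ∷ (# 0 , # 2) ∷
                    (# 3 , # 0) ∷ (# 4 , # 1) ∷ [])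

-- F1: vertex k (1..9) is # (k-1)
-- edges 12 14 23 34 25 35 56 19 49 59 69 67 27 78 17 38 48 68
F₁ : Graph
F₁ = fromEdges 9
  ((# 0 , # 1) ∷ (# 0 , # 3) ∷ (# 1 , # 2) ∷ (# 2 , # 3) ∷ (# 1 , # 4) ∷
   (# 2 , # 4) ∷ (# 4 , # 5) ∷ (# 0 , # 8) ∷ (# 3 , # 8) ∷ (# 4 , # 8) ∷
   (# 5 , # 8) ∷ (# 5 , # 6) ∷ (# 1 , # 6) ∷ (# 6 , # 7) ∷ (# 0 , # 6) ∷
   (# 2 , # 7) ∷ (# 3 , # 7) ∷ (# 5 , # 7) ∷ [])

-- F2: c1 c2 c3 s1 s2 x y = 0 1 2 3 4 5 6
-- edges c1c2 c1c3 c2c3 s1c1 s2c2 xs1 xc1 xs2 ys1 yc2 ys2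
F₂ : Graph
F₂ = fromEdges 7
  ((# 0 , # 1) ∷ (# 0 , # 2) ∷ (# 1 , # 2) ∷ (# 3 , # 0) ∷ (# 4 , # 1) ∷
   (# 5 , # 3) ∷ (# 5 , # 0) ∷ (# 5 , # 4) ∷ (# 6 , # 3) ∷ (# 6 , # 1) ∷
   (# 6 , # 4) ∷ [])

In𝓕₁ : Graph → Set
In𝓕₁ G = (Contains G antenna ⊎ Contains (complement G) antenna) × (G ≤ᵢ F₁)

In𝓕₂ : Graph → Set
In𝓕₂ G = (Contains G bull ⊎ Contains (complement G) bull) × (G ≤ᵢ F₂)

TriangleFree : Graph → Set
TriangleFree G = Free triangle G

module Submission where

-- If neither G nor its complement is triangle-free, take a triangle in each. They share at
-- most one vertex, so they span five or six vertices, and every claw- and co-claw-free graph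
-- containing such a configuration contains an induced bull. Relative to a fixed bull, each other
-- vertex has one of six neighbourhood types; two other vertices have distinct types, and their
-- adjacency depends only on the types. So G is determined by the set of types that occur, and
-- each of the 64 sets is either inconsistent, or makes G or its complement the net, or comes with
-- explicit embeddings of G into F₁ and of an antenna into G, or of G into F₂.

open import Defs
open import Data.Nat using (ℕ; zero; suc)
open import Data.Fin using (Fin; zero; suc; #_; _≟_)
open import Data.Fin.Properties using (suc-injective; any?)
open import Data.Bool using (Bool; true; false; not; _∧_; _∨_; _xor_; if_then_else_; T)
  renaming (_≟_ to _≟ᵇ_)
open import Data.Bool.Properties using (not-injective)
open import Data.Vec using (Vec; []; _∷_; lookup; tabulate)
open import Data.Vec.Properties using (lookup∘tabulate; tabulate-cong) renaming (≡-dec to ≡-decᵛ)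
open import Data.Vec.Relation.Unary.All using ([]; _∷_)
open import Data.Vec.Relation.Unary.AllPairs using ([]; _∷_)
open import Data.Vec.Relation.Unary.Unique.Propositional using (Unique)
open import Data.Vec.Relation.Unary.Unique.Propositional.Properties using (lookup-injective)
import Data.Vec.Functional as Fun
open import Data.List using ([]; _∷_)
open import Data.Maybe using (Maybe; just; nothing; _<∣>_; maybe′)
open import Data.Product using (∃; _×_; _,_; proj₁; proj₂)
open import Data.Sum using (_⊎_; inj₁; inj₂)
open import Data.Sum.Properties using (inj₁-injective; inj₂-injective) renaming (≡-dec to ≡-dec⊎)
open import Data.Unit using (tt)
open import Data.Empty using (⊥-elim)
open import Function using (_∘_; _on_)
open import Function.Definitions using (Injective)
open import Relation.Nullary using (¬_; Dec; yes; no; does)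
open import Relation.Nullary.Decidable
  using (⌊_⌋; toWitness; fromWitness; toWitnessFalse; fromWitnessFalse; ¬?; _×-dec_; _⊎-dec_; T?)
open import Relation.Binary.Definitions using (DecidableEquality)
open import Relation.Binary.PropositionalEquality
  using (_≡_; _≢_; refl; sym; trans; cong; cong₂; subst; ≢-sym)

T-∧⁺ : ∀ {a b} → T a → T b → T (a ∧ b)
T-∧⁺ {true} _ t = t

T-∧⁻ˡ : ∀ a {b} → T (a ∧ b) → T a
T-∧⁻ˡ true _ = tt

T-∧⁻ʳ : ∀ a {b} → T (a ∧ b) → T b
T-∧⁻ʳ true t = t

T-∨⁻ : ∀ a {b} → T (a ∨ b) → T a ⊎ T b
T-∨⁻ true  _ = inj₁ tt
T-∨⁻ false t = inj₂ t

T-not⁺ : ∀ {a} → ¬ T a → T (not a)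
T-not⁺ {false} _  = tt
T-not⁺ {true}  ¬t = ¬t tt

T-not⁻ : ∀ {a} → T (not a) → ¬ T a
T-not⁻ {false} _ ()

T-→ : ∀ a {b} → T (not a ∨ b) → T a → T b
T-→ true t _ = t

allFin : ∀ {k} → (Fin k → Bool) → Bool
allFin {zero}  f = true
allFin {suc k} f = f zero ∧ allFin (f ∘ suc)

allFin-sound : ∀ {k} (f : Fin k → Bool) → T (allFin f) → ∀ i → T (f i)
allFin-sound f t zero    = T-∧⁻ˡ (f zero) t
allFin-sound f t (suc i) = allFin-sound (f ∘ suc) (T-∧⁻ʳ (f zero) t) i

allFin-complete : ∀ {k} (f : Fin k → Bool) → (∀ i → T (f i)) → T (allFin f)
allFin-complete {zero}  f h = tt
allFin-complete {suc k} f h = T-∧⁺ (h zero) (allFin-complete (f ∘ suc) (h ∘ suc))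

allVec : ∀ k → (Vec Bool k → Bool) → Bool
allVec zero    f = f []
allVec (suc k) f = allVec k (f ∘ (true ∷_)) ∧ allVec k (f ∘ (false ∷_))

allVec-sound : ∀ k (f : Vec Bool k → Bool) → T (allVec k f) → ∀ v → T (f v)
allVec-sound zero    f t []          = t
allVec-sound (suc k) f t (true ∷ v)  = allVec-sound k _ (T-∧⁻ˡ (allVec k (f ∘ (true ∷_))) t) v
allVec-sound (suc k) f t (false ∷ v) = allVec-sound k _ (T-∧⁻ʳ (allVec k (f ∘ (true ∷_))) t) v

firstFin : ∀ {k} {A : Set} → (Fin k → Maybe A) → Maybe A
firstFin {zero}  f = nothing
firstFin {suc k} f = f zero <∣> firstFin (f ∘ suc)

∷-injective : ∀ {A : Set} {k} {x : A} {g : Fin k → A} →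
              (∀ i → g i ≢ x) → Injective _≡_ _≡_ g → Injective _≡_ _≡_ (x Fun.∷ g)
∷-injective x∉g g-inj {zero}  {zero}  _ = refl
∷-injective x∉g g-inj {zero}  {suc j} e = ⊥-elim (x∉g j (sym e))
∷-injective x∉g g-inj {suc i} {zero}  e = ⊥-elim (x∉g i e)
∷-injective x∉g g-inj {suc i} {suc j} e = cong suc (g-inj e)

-- A graph on Fin k listed vertex by vertex: in c ▷ r the new vertex is zero,
-- and r records its adjacency to the vertices of c (renumbered by suc).
infixl 5 _▷_
data Code : ℕ → Set where
  ∅   : Code zero
  _▷_ : ∀ {k} → Code k → Vec Bool k → Code (suc k)

codeAdj : ∀ {k} → Code k → Fin k → Fin k → Bool
codeAdj (c ▷ r) zero    zero    = false
codeAdj (c ▷ r) zero    (suc j) = lookup r j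
codeAdj (c ▷ r) (suc i) zero    = lookup r i
codeAdj (c ▷ r) (suc i) (suc j) = codeAdj c i j

encode : ∀ {k} → (Fin k → Fin k → Bool) → Code k
encode {zero}  A = ∅
encode {suc k} A = encode (λ i j → A (suc i) (suc j)) ▷ tabulate (A zero ∘ suc)

encode-cong : ∀ {k} {A B : Fin k → Fin k → Bool} → (∀ i j → A i j ≡ B i j) → encode A ≡ encode B
encode-cong {zero}  e = refl
encode-cong {suc k} e =
  cong₂ _▷_ (encode-cong (λ i j → e (suc i) (suc j))) (tabulate-cong (e zero ∘ suc))

codeAdj-encode : ∀ {k} (A : Fin k → Fin k → Bool) → (∀ i → A i i ≡ false) → (∀ i j → A i j ≡ A j i) →
                 ∀ i j → codeAdj (encode A) i j ≡ A i j
codeAdj-encode A irr A-sym zero    zero    = sym (irr zero)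
codeAdj-encode A irr A-sym zero    (suc j) = lookup∘tabulate (A zero ∘ suc) j
codeAdj-encode A irr A-sym (suc i) zero    = trans (lookup∘tabulate (A zero ∘ suc) i) (A-sym zero (suc i))
codeAdj-encode A irr A-sym (suc i) (suc j) =
  codeAdj-encode (λ i j → A (suc i) (suc j)) (irr ∘ suc) (λ i j → A-sym (suc i) (suc j)) i j

codeAdj-encode-on : (G : Graph) {k : ℕ} (g : Fin k → Fin (n G)) →
                    ∀ i j → codeAdj (encode (adj G on g)) i j ≡ adj G (g i) (g j)
codeAdj-encode-on G g = codeAdj-encode (adj G on g) (irrefl G ∘ g) (λ i j → adjSym G (g i) (g j))

induces : ∀ {L : Set} → DecidableEquality L → (L → L → Bool) → (X : Graph) → (Fin (n X) → L) → Bool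
induces _≟L_ A X p = allFin λ i → allFin λ j →
  ⌊ i ≟ j ⌋ ∨ (not ⌊ p i ≟L p j ⌋ ∧ ⌊ A (p i) (p j) ≟ᵇ adj X i j ⌋)

induces-sound : ∀ {L : Set} (_≟L_ : DecidableEquality L) (A : L → L → Bool) (X G : Graph)
  (p : Fin (n X) → L) (f : Fin (n X) → Fin (n G)) →
  (∀ {i j} → p i ≢ p j → f i ≢ f j × adj G (f i) (f j) ≡ A (p i) (p j)) →
  T (induces _≟L_ A X p) → X ≤ᵢ G
induces-sound _≟L_ A X G p f realises ok = f , f-inj , f-adj
  where
  pair : ∀ {i j} → i ≢ j → p i ≢ p j × A (p i) (p j) ≡ adj X i j
  pair {i} {j} i≢j
    with i ≟ j | p i ≟L p j | A (p i) (p j) ≟ᵇ adj X i j | allFin-sound _ (allFin-sound _ ok i) j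
  ... | yes i≡j | _        | _      | _  = ⊥-elim (i≢j i≡j)
  ... | no _    | no pi≢pj | yes eq | _  = pi≢pj , eq
  ... | no _    | yes _    | _      | ()
  ... | no _    | no _     | no _   | ()
  f-inj : Injective _≡_ _≡_ f
  f-inj {i} {j} e with i ≟ j
  ... | yes i≡j = i≡j
  ... | no  i≢j = ⊥-elim (proj₁ (realises (proj₁ (pair i≢j))) e)
  f-adj : ∀ i j → adj G (f i) (f j) ≡ adj X i j
  f-adj i j with i ≟ j
  ... | yes refl = trans (irrefl G _) (sym (irrefl X i))
  ... | no  i≢j  = trans (proj₂ (realises (proj₁ (pair i≢j)))) (proj₂ (pair i≢j))

induces-code-sound : (G : Graph) {k : ℕ} (g : Fin k → Fin (n G)) → Injective _≡_ _≡_ g →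
  (X : Graph) (p : Fin (n X) → Fin k) → T (induces _≟_ (codeAdj (encode (adj G on g))) X p) → X ≤ᵢ G
induces-code-sound G g g-inj X p =
  induces-sound _≟_ (codeAdj (encode (adj G on g))) X G p (g ∘ p)
    λ pi≢pj → pi≢pj ∘ g-inj , sym (codeAdj-encode-on G g _ _)

quadruple : ∀ {k} → Fin k → Fin k → Fin k → Fin k → Fin 4 → Fin k
quadruple c x y z = lookup (c ∷ x ∷ y ∷ z ∷ [])

clawShape : ∀ {k} → (Fin k → Fin k → Bool) → Fin k → Fin k → Fin k → Fin k → Bool
clawShape A c x y z = A c x ∧ A c y ∧ A c z ∧ not (A x y) ∧ not (A x z) ∧ not (A y z)
  ∧ not ⌊ x ≟ y ⌋ ∧ not ⌊ x ≟ z ⌋ ∧ not ⌊ y ≟ z ⌋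

-- Each disjunct opens with clawShape, which is implied by the induces test after it
-- but is far cheaper to evaluate; this keeps the exhaustive checks below fast.
clawOrCoClawAt : ∀ {k} → (Fin k → Fin k → Bool) → Fin k → Fin k → Fin k → Fin k → Bool
clawOrCoClawAt A c x y z =
    (clawShape A c x y z ∧ induces _≟_ A claw (quadruple c x y z))
  ∨ (clawShape (λ u v → not (A u v)) c x y z ∧ induces _≟_ A coClaw (quadruple c x y z))

clawOrCoClawAt-sound : ∀ {k} (A : Fin k → Fin k → Bool) c x y z → T (clawOrCoClawAt A c x y z) →
  T (induces _≟_ A claw (quadruple c x y z)) ⊎ T (induces _≟_ A coClaw (quadruple c x y z))
clawOrCoClawAt-sound A c x y z t with T-∨⁻ (clawShape A c x y z ∧ induces _≟_ A claw (quadruple c x y z)) t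
... | inj₁ t′ = inj₁ (T-∧⁻ʳ (clawShape A c x y z) t′)
... | inj₂ t′ = inj₂ (T-∧⁻ʳ (clawShape (λ u v → not (A u v)) c x y z) t′)

-- Only the 4-sets containing the newest vertex zero are tested, with zero as centre or as a leaf.
newVertexClawFree : ∀ {k} → Code (suc k) → Fin k → Fin k → Fin k → Bool
newVertexClawFree c a b d =
  not (clawOrCoClawAt (codeAdj c) zero (suc a) (suc b) (suc d)) ∧
  not (clawOrCoClawAt (codeAdj c) (suc a) zero (suc b) (suc d))

clawFreeCode : ∀ {k} → Code k → Bool
clawFreeCode ∅       = true
clawFreeCode (c ▷ r) =
  clawFreeCode c ∧ (allFin λ a → allFin λ b → allFin λ d → newVertexClawFree (c ▷ r) a b d)

-- The search only proposes a candidate; bullOrClaw checks it with induces.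
findBull : ∀ {k} → Code k → Maybe (Fin 5 → Fin k)
findBull c =
  firstFin λ a → firstFin λ b → if A a b then (firstFin λ t → if A a t ∧ A b t then (firstFin λ d →
  if A d a ∧ not (A d b) ∧ not (A d t) then (firstFin λ e →
  if A e b ∧ not (A e a) ∧ not (A e t) ∧ not (A e d) then just (lookup (a ∷ b ∷ t ∷ d ∷ e ∷ [])) else nothing)
  else nothing) else nothing) else nothing
  where A = codeAdj c

bullOrClaw : ∀ {k} → Code k → Bool
bullOrClaw c = not (clawFreeCode c) ∨ maybe′ (induces _≟_ (codeAdj c) bull) false (findBull c)

-- The code of z, y, x, c, b, a for a triangle abc of G and a disjoint triangle xyz of its
-- complement; rx, ry, rz are the adjacencies of x, y, z to c, b, a.
separatedCode : Vec Bool 3 → Vec Bool 3 → Vec Bool 3 → Code 6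
separatedCode rx ry rz = ∅ ▷ [] ▷ (true ∷ []) ▷ (true ∷ true ∷ []) ▷ rx ▷ (false ∷ ry) ▷ (false ∷ false ∷ rz)

separated-bullOrClaw : ∀ rx ry rz → T (bullOrClaw (separatedCode rx ry rz))
separated-bullOrClaw rx ry rz =
  allVec-sound 3 (λ rz → bullOrClaw (separatedCode rx ry rz))
    (allVec-sound 3 (λ ry → allVec 3 λ rz → bullOrClaw (separatedCode rx ry rz))
      (allVec-sound 3 (λ rx → allVec 3 λ ry → allVec 3 λ rz → bullOrClaw (separatedCode rx ry rz))
        tt rx) ry) rz

separatedCode-≡ : ∀ {p q r s t u} rx ry rz →
  p ≡ true → q ≡ true → r ≡ true → s ≡ false → t ≡ false → u ≡ false →
  separatedCode rx ry rz ≡ ∅ ▷ [] ▷ (p ∷ []) ▷ (q ∷ r ∷ []) ▷ rx ▷ (s ∷ ry) ▷ (t ∷ u ∷ rz)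
separatedCode-≡ rx ry rz refl refl refl refl refl refl = refl

-- The code of z, y, c, b, a for a triangle abc of G and a triangle ayz of its complement.
touchingCode : Bool → Bool → Bool → Bool → Code 5
touchingCode x₁ x₂ y₁ y₂ =
  ∅ ▷ [] ▷ (true ∷ []) ▷ (true ∷ true ∷ []) ▷ (x₁ ∷ x₂ ∷ false ∷ []) ▷ (false ∷ y₁ ∷ y₂ ∷ false ∷ [])

touching-bullOrClaw : ∀ x₁ x₂ y₁ y₂ → T (bullOrClaw (touchingCode x₁ x₂ y₁ y₂))
touching-bullOrClaw x₁ x₂ y₁ y₂ =
  allVec-sound 4 (λ { (x₁ ∷ x₂ ∷ y₁ ∷ y₂ ∷ []) → bullOrClaw (touchingCode x₁ x₂ y₁ y₂) })
    tt (x₁ ∷ x₂ ∷ y₁ ∷ y₂ ∷ [])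

touchingCode-≡ : ∀ {p q r s t u} x₁ x₂ y₁ y₂ →
  p ≡ true → q ≡ true → r ≡ true → s ≡ false → t ≡ false → u ≡ false →
  touchingCode x₁ x₂ y₁ y₂ ≡ ∅ ▷ [] ▷ (p ∷ []) ▷ (q ∷ r ∷ []) ▷ (x₁ ∷ x₂ ∷ s ∷ []) ▷ (t ∷ y₁ ∷ y₂ ∷ u ∷ [])
touchingCode-≡ x₁ x₂ y₁ y₂ refl refl refl refl refl refl = refl

record Triangle (G : Graph) : Set where
  constructor mkTriangle
  field
    a b c : Fin (n G)
    ab : adj G a b ≡ true
    bc : adj G b c ≡ true
    ac : adj G a c ≡ true

triangle? : (G : Graph) → TriangleFree G ⊎ Triangle G
triangle? G with any? (λ a → any? λ b → any? λ c →
                   (adj G a b ≟ᵇ true) ×-dec (adj G b c ≟ᵇ true) ×-dec (adj G a c ≟ᵇ true))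
... | yes (a , b , c , ab , bc , ac) = inj₂ (mkTriangle a b c ab bc ac)
... | no ∄ = inj₁ λ (f , _ , f-adj) →
  ∄ (f (# 0) , f (# 1) , f (# 2) , f-adj (# 0) (# 1) , f-adj (# 1) (# 2) , f-adj (# 0) (# 2))

-- A vertex is labelled by its place in the bull or by its neighbourhood type.
Label : Set
Label = Fin 5 ⊎ Fin 6

_≟ᴸ_ : DecidableEquality Label
_≟ᴸ_ = ≡-dec⊎ _≟_ _≟_

-- The possible adjacency vectors, to the bull vertices 0 … 4, of a vertex off the bull.
neighbourhoodType : Fin 6 → Vec Bool 5
neighbourhoodType = lookup
  ( (false ∷ false ∷ true  ∷ false ∷ false ∷ [])
  ∷ (false ∷ false ∷ true  ∷ false ∷ true  ∷ [])
  ∷ (false ∷ false ∷ true  ∷ true  ∷ false ∷ [])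
  ∷ (false ∷ true  ∷ false ∷ true  ∷ true  ∷ [])
  ∷ (true  ∷ false ∷ false ∷ true  ∷ true  ∷ [])
  ∷ (true  ∷ true  ∷ false ∷ true  ∷ true  ∷ [])
  ∷ [])

typeGraph : Graph
typeGraph = fromEdges 6 ((# 1 , # 2) ∷ (# 1 , # 4) ∷ (# 2 , # 3) ∷ [])

-- A vertex of type 0 or 5 turns out to be the only vertex off the bull.
solitary : Fin 6 → Bool
solitary c = ⌊ c ≟ # 0 ⌋ ∨ ⌊ c ≟ # 5 ⌋

model : Label → Label → Bool
model (inj₁ i) (inj₁ j) = adj bull i j
model (inj₁ i) (inj₂ c) = lookup (neighbourhoodType c) i
model (inj₂ c) (inj₁ i) = lookup (neighbourhoodType c) i
model (inj₂ c) (inj₂ d) = adj typeGraph c d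

bullCode : Code 5
bullCode = ∅ ▷ [] ▷ (false ∷ []) ▷ (false ∷ false ∷ [])
             ▷ (true ∷ false ∷ true ∷ []) ▷ (true ∷ true ∷ true ∷ false ∷ [])

encode-bull : encode (adj bull) ≡ bullCode
encode-bull = refl

neighbourhoodType-complete : ∀ r → T (clawFreeCode (bullCode ▷ r)) → ∃ λ c → r ≡ neighbourhoodType c
neighbourhoodType-complete r free =
  toWitness {a? = isType? r} (T-→ (clawFreeCode (bullCode ▷ r)) (allVec-sound 5 check tt r) free)
  where
  isType? : ∀ r → Dec (∃ λ c → r ≡ neighbourhoodType c)
  isType? r = any? λ c → ≡-decᵛ _≟ᵇ_ r (neighbourhoodType c)
  check : Vec Bool 5 → Bool
  check r = not (clawFreeCode (bullCode ▷ r)) ∨ ⌊ isType? r ⌋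

pairCode : Fin 6 → Fin 6 → Bool → Code 7
pairCode c₁ c₂ e = bullCode ▷ neighbourhoodType c₂ ▷ (e ∷ neighbourhoodType c₁)

pairCheck : Fin 6 → Fin 6 → Bool → Bool
pairCheck c₁ c₂ e = not (clawFreeCode (pairCode c₁ c₂ e))
  ∨ (not ⌊ c₁ ≟ c₂ ⌋ ∧ ⌊ e ≟ᵇ adj typeGraph c₁ c₂ ⌋ ∧ not (solitary c₁))

pairCheck-both : ∀ c₁ c₂ → T (pairCheck c₁ c₂ true ∧ pairCheck c₁ c₂ false)
pairCheck-both c₁ c₂ = allFin-sound (λ c₂ → pairCheck c₁ c₂ true ∧ pairCheck c₁ c₂ false)
    (allFin-sound (λ c₁ → allFin λ c₂ → pairCheck c₁ c₂ true ∧ pairCheck c₁ c₂ false) tt c₁) c₂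

pairCheck-holds : ∀ c₁ c₂ e → T (pairCheck c₁ c₂ e)
pairCheck-holds c₁ c₂ true  = T-∧⁻ˡ (pairCheck c₁ c₂ true) (pairCheck-both c₁ c₂)
pairCheck-holds c₁ c₂ false = T-∧⁻ʳ (pairCheck c₁ c₂ true) (pairCheck-both c₁ c₂)

neighbourhoodType-pair : ∀ c₁ c₂ e → T (clawFreeCode (pairCode c₁ c₂ e)) →
                         c₁ ≢ c₂ × e ≡ adj typeGraph c₁ c₂ × T (not (solitary c₁))
neighbourhoodType-pair c₁ c₂ e free =
    toWitnessFalse (T-∧⁻ˡ (not ⌊ c₁ ≟ c₂ ⌋) t)
  , toWitness (T-∧⁻ˡ ⌊ e ≟ᵇ adj typeGraph c₁ c₂ ⌋ (T-∧⁻ʳ (not ⌊ c₁ ≟ c₂ ⌋) t))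
  , T-∧⁻ʳ ⌊ e ≟ᵇ adj typeGraph c₁ c₂ ⌋ (T-∧⁻ʳ (not ⌊ c₁ ≟ c₂ ⌋) t)
  where t = T-→ (clawFreeCode (pairCode c₁ c₂ e)) (pairCheck-holds c₁ c₂ e) free

present : Vec Bool 6 → Label → Bool
present ts (inj₁ _) = true
present ts (inj₂ c) = lookup ts c

allLabels : (Label → Bool) → Bool
allLabels f = allFin (f ∘ inj₁) ∧ allFin (f ∘ inj₂)

allLabels-sound : ∀ f → T (allLabels f) → ∀ a → T (f a)
allLabels-sound f t (inj₁ i) = allFin-sound (f ∘ inj₁) (T-∧⁻ˡ (allFin (f ∘ inj₁)) t) i
allLabels-sound f t (inj₂ c) = allFin-sound (f ∘ inj₂) (T-∧⁻ʳ (allFin (f ∘ inj₁)) t) c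

modelPairEmbeds : Vec Bool 6 → Bool → (X : Graph) → (Label → Fin (n X)) → Label → Label → Bool
modelPairEmbeds ts flip X p a b = not (present ts a ∧ present ts b ∧ not ⌊ a ≟ᴸ b ⌋)
  ∨ (not ⌊ p a ≟ p b ⌋ ∧ ⌊ adj X (p a) (p b) ≟ᵇ flip xor model a b ⌋)

modelEmbeds : Vec Bool 6 → Bool → (X : Graph) → (Label → Fin (n X)) → Bool
modelEmbeds ts flip X p = allLabels λ a → allLabels (modelPairEmbeds ts flip X p a)

coveredBy : Vec Bool 6 → ∀ {m} → (Label → Fin m) → (Fin m → Label) → Bool
coveredBy ts p r = allFin λ k → present ts (r k) ∧ ⌊ p (r k) ≟ k ⌋

modelInduces : Vec Bool 6 → Bool → (Y : Graph) → (Fin (n Y) → Label) → Bool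
modelInduces ts flip Y q = allFin (present ts ∘ q) ∧ induces _≟ᴸ_ (λ a b → flip xor model a b) Y q

module Realisation (H : Graph) (ts : Vec Bool 6) (flip : Bool) (ℓ : Fin (n H) → Label)
  (ℓ-present : ∀ v → T (present ts (ℓ v)))
  (ℓ-onto : ∀ a → T (present ts a) → ∃ λ v → ℓ v ≡ a)
  (ℓ-injective : Injective _≡_ _≡_ ℓ)
  (ℓ-adj : ∀ {u v} → u ≢ v → adj H u v ≡ flip xor model (ℓ u) (ℓ v)) where

  modelEmbeds-sound : (X : Graph) (p : Label → Fin (n X)) → T (modelEmbeds ts flip X p) → H ≤ᵢ X
  modelEmbeds-sound X p ok = p ∘ ℓ , pℓ-inj , pℓ-adj
    where
    pair : ∀ {u v} → u ≢ v → p (ℓ u) ≢ p (ℓ v) × adj X (p (ℓ u)) (p (ℓ v)) ≡ flip xor model (ℓ u) (ℓ v)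
    pair {u} {v} u≢v = toWitnessFalse (T-∧⁻ˡ (not ⌊ p (ℓ u) ≟ p (ℓ v) ⌋) t)
                     , toWitness {a? = adj X (p (ℓ u)) (p (ℓ v)) ≟ᵇ flip xor model (ℓ u) (ℓ v)}
                         (T-∧⁻ʳ (not ⌊ p (ℓ u) ≟ p (ℓ v) ⌋) t)
      where
      t = T-→ (present ts (ℓ u) ∧ present ts (ℓ v) ∧ not ⌊ ℓ u ≟ᴸ ℓ v ⌋)
              (allLabels-sound (modelPairEmbeds ts flip X p (ℓ u))
                 (allLabels-sound (λ a → allLabels (modelPairEmbeds ts flip X p a)) ok (ℓ u)) (ℓ v))
              (T-∧⁺ (ℓ-present u) (T-∧⁺ (ℓ-present v) (fromWitnessFalse (u≢v ∘ ℓ-injective))))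
    pℓ-inj : Injective _≡_ _≡_ (p ∘ ℓ)
    pℓ-inj {u} {v} e with u ≟ v
    ... | yes u≡v = u≡v
    ... | no  u≢v = ⊥-elim (proj₁ (pair u≢v) e)
    pℓ-adj : ∀ u v → adj X (p (ℓ u)) (p (ℓ v)) ≡ adj H u v
    pℓ-adj u v with u ≟ v
    ... | yes refl = trans (irrefl X _) (sym (irrefl H u))
    ... | no  u≢v  = trans (proj₂ (pair u≢v)) (sym (ℓ-adj u≢v))

  modelIso-sound : (X : Graph) (p : Label → Fin (n X)) (r : Fin (n X) → Label) →
                   T (modelEmbeds ts flip X p) → T (coveredBy ts p r) → H ≅ X
  modelIso-sound X p r embeds covered = p ∘ ℓ , proj₁ (proj₂ E) , onto , proj₂ (proj₂ E)
    where
    E = modelEmbeds-sound X p embeds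
    onto : ∀ k → ∃ λ v → ∀ {w} → w ≡ v → p (ℓ w) ≡ k
    onto k = proj₁ W , λ { refl → trans (cong p (proj₂ W)) p-r }
      where
      c = allFin-sound _ covered k
      W = ℓ-onto (r k) (T-∧⁻ˡ (present ts (r k)) c)
      p-r : p (r k) ≡ k
      p-r = toWitness {a? = p (r k) ≟ k} (T-∧⁻ʳ (present ts (r k)) c)

  modelInduces-sound : (Y : Graph) (q : Fin (n Y) → Label) → T (modelInduces ts flip Y q) → Y ≤ᵢ H
  modelInduces-sound Y q ok =
    induces-sound _≟ᴸ_ (λ a b → flip xor model a b) Y H q f realises (T-∧⁻ʳ (allFin (present ts ∘ q)) ok)
    where
    W : ∀ i → ∃ λ v → ℓ v ≡ q i
    W i = ℓ-onto (q i) (allFin-sound _ (T-∧⁻ˡ (allFin (present ts ∘ q)) ok) i)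
    f : Fin (n Y) → Fin (n H)
    f = proj₁ ∘ W
    realises : ∀ {i j} → q i ≢ q j → f i ≢ f j × adj H (f i) (f j) ≡ flip xor model (q i) (q j)
    realises {i} {j} qi≢qj =
      fi≢fj , trans (ℓ-adj fi≢fj) (cong₂ (λ a b → flip xor model a b) (proj₂ (W i)) (proj₂ (W j)))
      where
      fi≢fj : f i ≢ f j
      fi≢fj e = qi≢qj (trans (sym (proj₂ (W i))) (trans (cong ℓ e) (proj₂ (W j))))

labelMap : ∀ {m} → Vec (Fin m) 5 → Vec (Fin m) 6 → Label → Fin m
labelMap onBull onTypes (inj₁ i) = lookup onBull i
labelMap onBull onTypes (inj₂ c) = lookup onTypes c

data Certificate : Set where
  solitaryClash : Fin 6 → Certificate
  bullInF₂      : (Label → Fin 7) → Certificate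
  antennaInF₁   : (Fin 6 → Label) → Certificate
  netIso        : Bool → (Label → Fin 6) → (Fin 6 → Label) → Certificate

-- In these maps an entry # 0 for a type that never occurs with the map is a dummy.
modelInF₁ : Label → Fin 9
modelInF₁ = labelMap (# 0 ∷ # 1 ∷ # 6 ∷ # 3 ∷ # 4 ∷ []) (# 0 ∷ # 5 ∷ # 7 ∷ # 2 ∷ # 8 ∷ # 0 ∷ [])

F₂-via₃₄ F₂-via₂₃ F₂-via₁₄ : Label → Fin 7
F₂-via₃₄ = labelMap (# 0 ∷ # 1 ∷ # 2 ∷ # 3 ∷ # 4 ∷ []) (# 0 ∷ # 0 ∷ # 0 ∷ # 6 ∷ # 5 ∷ # 0 ∷ [])
F₂-via₂₃ = labelMap (# 3 ∷ # 0 ∷ # 5 ∷ # 6 ∷ # 2 ∷ []) (# 0 ∷ # 0 ∷ # 4 ∷ # 1 ∷ # 0 ∷ # 0 ∷ [])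
F₂-via₁₄ = labelMap (# 0 ∷ # 3 ∷ # 5 ∷ # 2 ∷ # 6 ∷ []) (# 0 ∷ # 4 ∷ # 0 ∷ # 0 ∷ # 1 ∷ # 0 ∷ [])

antenna-via₂₄ antenna-via₁₃ antenna-via₁₂ : Fin 6 → Label
antenna-via₂₄ = lookup (inj₁ (# 1) ∷ inj₁ (# 0) ∷ inj₂ (# 4) ∷ inj₁ (# 4) ∷ inj₁ (# 3) ∷ inj₂ (# 2) ∷ [])
antenna-via₁₃ = lookup (inj₁ (# 0) ∷ inj₁ (# 1) ∷ inj₂ (# 3) ∷ inj₁ (# 3) ∷ inj₁ (# 4) ∷ inj₂ (# 1) ∷ [])
antenna-via₁₂ = lookup (inj₁ (# 0) ∷ inj₁ (# 2) ∷ inj₂ (# 2) ∷ inj₁ (# 3) ∷ inj₂ (# 1) ∷ inj₁ (# 4) ∷ [])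

valid : Vec Bool 6 → Certificate → Bool
valid ts (solitaryClash c)  = lookup ts c ∧ solitary c ∧ ⌊ any? (λ c′ → ¬? (c′ ≟ c) ×-dec T? (lookup ts c′)) ⌋
valid ts (bullInF₂ p)       = modelEmbeds ts false F₂ p
valid ts (antennaInF₁ q)    = modelEmbeds ts false F₁ modelInF₁ ∧ modelInduces ts false antenna q
valid ts (netIso flip p r)  = modelEmbeds ts flip net p ∧ coveredBy ts p r

-- The argument lists which of the six types occur.
certificate : Vec Bool 6 → Certificate
certificate (true  ∷ false ∷ false ∷ false ∷ false ∷ false ∷ []) =
  netIso false (labelMap (# 0 ∷ # 1 ∷ # 2 ∷ # 3 ∷ # 4 ∷ []) (# 5 ∷ # 0 ∷ # 0 ∷ # 0 ∷ # 0 ∷ # 0 ∷ []))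
               (lookup (inj₁ (# 0) ∷ inj₁ (# 1) ∷ inj₁ (# 2) ∷ inj₁ (# 3) ∷ inj₁ (# 4) ∷ inj₂ (# 0) ∷ []))
certificate (false ∷ false ∷ false ∷ false ∷ false ∷ true  ∷ []) =
  netIso true  (labelMap (# 3 ∷ # 4 ∷ # 2 ∷ # 1 ∷ # 0 ∷ []) (# 0 ∷ # 0 ∷ # 0 ∷ # 0 ∷ # 0 ∷ # 5 ∷ []))
               (lookup (inj₁ (# 4) ∷ inj₁ (# 3) ∷ inj₁ (# 2) ∷ inj₁ (# 0) ∷ inj₁ (# 1) ∷ inj₂ (# 5) ∷ []))
certificate (true ∷ _)                         = solitaryClash (# 0)
certificate (_ ∷ _ ∷ _ ∷ _ ∷ _ ∷ true ∷ [])   = solitaryClash (# 5)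
certificate (_ ∷ _ ∷ true ∷ _ ∷ true ∷ _)      = antennaInF₁ antenna-via₂₄
certificate (_ ∷ true ∷ _ ∷ true ∷ _)          = antennaInF₁ antenna-via₁₃
certificate (_ ∷ true ∷ true ∷ _)              = antennaInF₁ antenna-via₁₂
certificate (_ ∷ false ∷ false ∷ _)            = bullInF₂ F₂-via₃₄
certificate (_ ∷ false ∷ true ∷ _)             = bullInF₂ F₂-via₂₃
certificate (_ ∷ true ∷ false ∷ _)             = bullInF₂ F₂-via₁₄

certificate-valid : ∀ ts → T (valid ts (certificate ts))
certificate-valid = allVec-sound 6 (λ ts → valid ts (certificate ts)) tt

NetOr𝓕₁Or𝓕₂ : Graph → Set
NetOr𝓕₁Or𝓕₂ G =
  (G ≅ net ⊎ complement G ≅ net) ⊎ ((In𝓕₁ G ⊎ In𝓕₁ (complement G)) ⊎ (In𝓕₂ G ⊎ In𝓕₂ (complement G)))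

module ClawFree (G : Graph) (claw-free : Free claw G) (coClaw-free : Free coClaw G) where

  V : Set
  V = Fin (n G)

  noClawOrCoClaw : ∀ {k} (g : Fin k → V) → Injective _≡_ _≡_ g →
                   ∀ c x y z → ¬ T (clawOrCoClawAt (codeAdj (encode (adj G on g))) c x y z)
  noClawOrCoClaw g g-inj c x y z t with clawOrCoClawAt-sound (codeAdj (encode (adj G on g))) c x y z t
  ... | inj₁ isClaw   = claw-free   (induces-code-sound G g g-inj claw   (quadruple c x y z) isClaw)
  ... | inj₂ isCoClaw = coClaw-free (induces-code-sound G g g-inj coClaw (quadruple c x y z) isCoClaw)

  clawFreeCode-encode : ∀ {k} (g : Fin k → V) → Injective _≡_ _≡_ g → T (clawFreeCode (encode (adj G on g)))
  clawFreeCode-encode {zero}  g g-inj = tt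
  clawFreeCode-encode {suc k} g g-inj =
    T-∧⁺ {clawFreeCode (encode (adj G on (g ∘ suc)))}
      (clawFreeCode-encode (g ∘ suc) (suc-injective ∘ g-inj))
      (allFin-complete _ λ a → allFin-complete _ λ b →
       allFin-complete (newVertexClawFree (encode (adj G on g)) a b) λ d →
         T-∧⁺ (T-not⁺ (noClawOrCoClaw g g-inj zero (suc a) (suc b) (suc d)))
              (T-not⁺ (noClawOrCoClaw g g-inj (suc a) zero (suc b) (suc d))))

  clawFreeCode-≡ : ∀ {k} (g : Fin k → V) → Injective _≡_ _≡_ g →
                   (L : Code k) → encode (adj G on g) ≡ L → T (clawFreeCode L)
  clawFreeCode-≡ g g-inj L refl = clawFreeCode-encode g g-inj

  bullOrClaw-sound : ∀ {k} (g : Fin k → V) → Injective _≡_ _≡_ g → (L : Code k) → L ≡ encode (adj G on g) →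
                     T (bullOrClaw L) → bull ≤ᵢ G
  bullOrClaw-sound g g-inj L refl t with T-∨⁻ (not (clawFreeCode L)) t
  ... | inj₁ notFree = ⊥-elim (T-not⁻ notFree (clawFreeCode-encode g g-inj))
  ... | inj₂ found with findBull L
  ...   | just p  = induces-code-sound G g g-inj bull p found
  ...   | nothing = ⊥-elim found

  adj-sym : ∀ {u v b} → adj G u v ≡ b → adj G v u ≡ b
  adj-sym {u} {v} = trans (adjSym G v u)

  adj⇒≢ : ∀ {u v} → adj G u v ≡ true → u ≢ v
  adj⇒≢ {u} uv refl with trans (sym (irrefl G u)) uv
  ... | ()

  non-neighbour-≢ : ∀ {w v u} → adj G w u ≡ false → adj G v u ≡ true → w ≢ v
  non-neighbour-≢ wu vu refl with trans (sym wu) vu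
  ... | ()

  complement-adj : ∀ {u v} → adj (complement G) u v ≡ true → u ≢ v × adj G u v ≡ false
  complement-adj {u} {v} uv with u ≟ v
  ... | no u≢v = u≢v , not-injective {y = false} uv

  complement-adj-≢ : ∀ {u v} → u ≢ v → (if does (u ≟ v) then false else not (adj G u v)) ≡ not (adj G u v)
  complement-adj-≢ {u} {v} u≢v with u ≟ v
  ... | yes u≡v = ⊥-elim (u≢v u≡v)
  ... | no _    = refl

  _∈△_ : V → Triangle G → Set
  v ∈△ t = v ≡ Triangle.a t ⊎ v ≡ Triangle.b t ⊎ v ≡ Triangle.c t

  _∈△?_ : ∀ v t → Dec (v ∈△ t)
  v ∈△? t = (v ≟ Triangle.a t) ⊎-dec (v ≟ Triangle.b t) ⊎-dec (v ≟ Triangle.c t)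

  rotate : Triangle G → Triangle G
  rotate (mkTriangle a b c ab bc ac) = mkTriangle b c a bc (adj-sym ac) (adj-sym ab)

  bull-separated : (t : Triangle G) (x y z : V) → x ≢ y → x ≢ z → y ≢ z →
                   adj G x y ≡ false → adj G x z ≡ false → adj G y z ≡ false →
                   ¬ x ∈△ t → ¬ y ∈△ t → ¬ z ∈△ t → bull ≤ᵢ G
  bull-separated (mkTriangle a b c ab bc ac) x y z x≢y x≢z y≢z xy xz yz x∉ y∉ z∉ =
    bullOrClaw-sound (lookup vs) (λ {i} {j} → lookup-injective distinct i j)
      (separatedCode rx ry rz) code-≡ (separated-bullOrClaw rx ry rz)
    where
    vs = z ∷ y ∷ x ∷ c ∷ b ∷ a ∷ []
    row : V → Vec Bool 3
    row v = adj G v c ∷ adj G v b ∷ adj G v a ∷ []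
    rx = row x
    ry = row y
    rz = row z
    code-≡ : separatedCode rx ry rz ≡ encode (adj G on lookup vs)
    code-≡ = separatedCode-≡ rx ry rz (adj-sym ab) (adj-sym bc) (adj-sym ac)
                                      (adj-sym xy) (adj-sym yz) (adj-sym xz)
    distinct : Unique vs
    distinct = (≢-sym y≢z ∷ ≢-sym x≢z ∷ z∉ ∘ inj₂ ∘ inj₂ ∷ z∉ ∘ inj₂ ∘ inj₁ ∷ z∉ ∘ inj₁ ∷ [])
             ∷ (≢-sym x≢y ∷ y∉ ∘ inj₂ ∘ inj₂ ∷ y∉ ∘ inj₂ ∘ inj₁ ∷ y∉ ∘ inj₁ ∷ [])
             ∷ (x∉ ∘ inj₂ ∘ inj₂ ∷ x∉ ∘ inj₂ ∘ inj₁ ∷ x∉ ∘ inj₁ ∷ [])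
             ∷ (≢-sym (adj⇒≢ bc) ∷ ≢-sym (adj⇒≢ ac) ∷ [])
             ∷ (≢-sym (adj⇒≢ ab) ∷ [])
             ∷ [] ∷ []

  bull-touching-a : (t : Triangle G) (x y z : V) → x ≡ Triangle.a t → x ≢ y → x ≢ z → y ≢ z →
                    adj G x y ≡ false → adj G x z ≡ false → adj G y z ≡ false → bull ≤ᵢ G
  bull-touching-a (mkTriangle a b c ab bc ac) x y z refl x≢y x≢z y≢z xy xz yz =
    bullOrClaw-sound (lookup vs) (λ {i} {j} → lookup-injective distinct i j)
      (touchingCode y₁ y₂ z₁ z₂) code-≡ (touching-bullOrClaw y₁ y₂ z₁ z₂)
    where
    vs = z ∷ y ∷ c ∷ b ∷ a ∷ []
    y₁ = adj G y c
    y₂ = adj G y b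
    z₁ = adj G z c
    z₂ = adj G z b
    code-≡ : touchingCode y₁ y₂ z₁ z₂ ≡ encode (adj G on lookup vs)
    code-≡ = touchingCode-≡ y₁ y₂ z₁ z₂ (adj-sym ab) (adj-sym bc) (adj-sym ac)
                                        (adj-sym xy) (adj-sym yz) (adj-sym xz)
    distinct : Unique vs
    distinct = (≢-sym y≢z ∷ non-neighbour-≢ (adj-sym xz) (adj-sym ac)
                          ∷ non-neighbour-≢ (adj-sym xz) (adj-sym ab) ∷ ≢-sym x≢z ∷ [])
             ∷ (non-neighbour-≢ (adj-sym xy) (adj-sym ac) ∷ non-neighbour-≢ (adj-sym xy) (adj-sym ab)
                                                          ∷ ≢-sym x≢y ∷ [])
             ∷ (≢-sym (adj⇒≢ bc) ∷ ≢-sym (adj⇒≢ ac) ∷ [])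
             ∷ (≢-sym (adj⇒≢ ab) ∷ [])
             ∷ [] ∷ []

  bull-touching : (t : Triangle G) (x y z : V) → x ∈△ t → x ≢ y → x ≢ z → y ≢ z →
                  adj G x y ≡ false → adj G x z ≡ false → adj G y z ≡ false → bull ≤ᵢ G
  bull-touching t x y z (inj₁ x≡a)        = bull-touching-a t x y z x≡a
  bull-touching t x y z (inj₂ (inj₁ x≡b)) = bull-touching-a (rotate t) x y z x≡b
  bull-touching t x y z (inj₂ (inj₂ x≡c)) = bull-touching-a (rotate (rotate t)) x y z x≡c

  bull-from-triangles : Triangle G → Triangle (complement G) → bull ≤ᵢ G
  bull-from-triangles t (mkTriangle x y z xy yz xz)
    with complement-adj xy | complement-adj yz | complement-adj xz
  ... | x≢y , xy′ | y≢z , yz′ | x≢z , xz′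
    with x ∈△? t | y ∈△? t | z ∈△? t
  ... | yes x∈ | _      | _      = bull-touching t x y z x∈ x≢y x≢z y≢z xy′ xz′ yz′
  ... | no _   | yes y∈ | _      = bull-touching t y x z y∈ (≢-sym x≢y) y≢z x≢z (adj-sym xy′) yz′ xz′
  ... | no _   | no _   | yes z∈ =
    bull-touching t z x y z∈ (≢-sym x≢z) (≢-sym y≢z) x≢y (adj-sym xz′) (adj-sym yz′) xy′
  ... | no x∉  | no y∉  | no z∉  = bull-separated t x y z x≢y x≢z y≢z xy′ xz′ yz′ x∉ y∉ z∉

  module AroundBull (β : Fin 5 → V) (β-inj : Injective _≡_ _≡_ β)
                    (β-adj : ∀ i j → adj G (β i) (β j) ≡ adj bull i j) where

    typeOf : V → Vec Bool 5
    typeOf v = tabulate (adj G v ∘ β)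

    typeOf-lookup : ∀ {v r} → typeOf v ≡ r → ∀ i → adj G v (β i) ≡ lookup r i
    typeOf-lookup {v} t i = trans (sym (lookup∘tabulate (adj G v ∘ β) i)) (cong (λ r → lookup r i) t)

    encode-β : encode (adj G on β) ≡ bullCode
    encode-β = trans (encode-cong β-adj) encode-bull

    OffBull : V → Set
    OffBull v = ∀ i → β i ≢ v

    encode-extend : ∀ v → encode (adj G on (v Fun.∷ β)) ≡ bullCode ▷ typeOf v
    encode-extend v = cong (_▷ typeOf v) encode-β

    typeOf-admissible : ∀ {v} → OffBull v → ∃ λ c → typeOf v ≡ neighbourhoodType c
    typeOf-admissible {v} off = neighbourhoodType-complete (typeOf v)
      (clawFreeCode-≡ (v Fun.∷ β) (∷-injective off β-inj) (bullCode ▷ typeOf v) (encode-extend v))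

    typePair : ∀ {u v} c₁ c₂ → u ≢ v → OffBull u → OffBull v →
               typeOf u ≡ neighbourhoodType c₁ → typeOf v ≡ neighbourhoodType c₂ →
               c₁ ≢ c₂ × adj G u v ≡ adj typeGraph c₁ c₂ × T (not (solitary c₁))
    typePair {u} {v} c₁ c₂ u≢v off-u off-v tu tv = neighbourhoodType-pair c₁ c₂ (adj G u v)
      (clawFreeCode-≡ (u Fun.∷ v Fun.∷ β) (∷-injective u∉ (∷-injective off-v β-inj))
        (pairCode c₁ c₂ (adj G u v))
        (cong₂ _▷_ (trans (encode-extend v) (cong (bullCode ▷_) tv)) (cong (adj G u v ∷_) tu)))
      where
      u∉ : ∀ i → (v Fun.∷ β) i ≢ u
      u∉ zero    = ≢-sym u≢v
      u∉ (suc i) = off-u i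

    data Position (v : V) : Set where
      onBull  : ∀ i → β i ≡ v → Position v
      offBull : ∀ c → OffBull v → typeOf v ≡ neighbourhoodType c → Position v

    position : ∀ v → Position v
    position v with any? (λ i → β i ≟ v)
    ... | yes (i , βi≡v) = onBull i βi≡v
    ... | no ∉β with typeOf-admissible (λ i βi≡v → ∉β (i , βi≡v))
    ...   | c , t = offBull c (λ i βi≡v → ∉β (i , βi≡v)) t

    labelOf : ∀ {v} → Position v → Label
    labelOf (onBull i _)    = inj₁ i
    labelOf (offBull c _ _) = inj₂ c

    label : V → Label
    label v = labelOf (position v)

    labelOf-adj : ∀ {u v} → u ≢ v → (pu : Position u) (pv : Position v) →
                  adj G u v ≡ model (labelOf pu) (labelOf pv)
    labelOf-adj _ (onBull i refl) (onBull j refl) = β-adj i j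
    labelOf-adj {v = v} _ (onBull i refl) (offBull c _ t) = trans (adjSym G (β i) v) (typeOf-lookup t i)
    labelOf-adj _ (offBull c _ t) (onBull i refl) = typeOf-lookup t i
    labelOf-adj u≢v (offBull c₁ off-u tu) (offBull c₂ off-v tv) =
      proj₁ (proj₂ (typePair c₁ c₂ u≢v off-u off-v tu tv))

    labelOf-injective : ∀ {u v} (pu : Position u) (pv : Position v) → labelOf pu ≡ labelOf pv → u ≡ v
    labelOf-injective (onBull i refl) (onBull j refl) e = cong β (inj₁-injective e)
    labelOf-injective (onBull _ _) (offBull _ _ _) ()
    labelOf-injective (offBull _ _ _) (onBull _ _) ()
    labelOf-injective {u} {v} (offBull c₁ off-u tu) (offBull c₂ off-v tv) e with u ≟ v
    ... | yes u≡v = u≡v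
    ... | no  u≢v = ⊥-elim (proj₁ (typePair c₁ c₂ u≢v off-u off-v tu tv) (inj₂-injective e))

    labelOf-type : ∀ {u c} (pu : Position u) → labelOf pu ≡ inj₂ c →
                   OffBull u × typeOf u ≡ neighbourhoodType c
    labelOf-type (offBull _ off t) refl = off , t

    labelOf-β : ∀ i (p : Position (β i)) → labelOf p ≡ inj₁ i
    labelOf-β i (onBull j βj≡βi)  = cong inj₁ (β-inj βj≡βi)
    labelOf-β i (offBull _ off _) = ⊥-elim (off i refl)

    occurs? : ∀ c → Dec (∃ λ v → label v ≡ inj₂ c)
    occurs? c = any? λ v → label v ≟ᴸ inj₂ c

    presentTypes : Vec Bool 6
    presentTypes = tabulate (⌊_⌋ ∘ occurs?)

    label-present : ∀ v → T (present presentTypes (label v))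
    label-present v with label v in eq
    ... | inj₁ _ = tt
    ... | inj₂ c = subst T (sym (lookup∘tabulate (⌊_⌋ ∘ occurs?) c)) (fromWitness {a? = occurs? c} (v , eq))

    label-onto : ∀ a → T (present presentTypes a) → ∃ λ v → label v ≡ a
    label-onto (inj₁ i) _ = β i , labelOf-β i (position (β i))
    label-onto (inj₂ c) t = toWitness {a? = occurs? c} (subst T (lookup∘tabulate (⌊_⌋ ∘ occurs?) c) t)

    label-injective : Injective _≡_ _≡_ label
    label-injective {u} {v} = labelOf-injective (position u) (position v)

    label-adj : ∀ {u v} → u ≢ v → adj G u v ≡ false xor model (label u) (label v)
    label-adj {u} {v} u≢v = labelOf-adj u≢v (position u) (position v)

    label-coadj : ∀ {u v} → u ≢ v → adj (complement G) u v ≡ true xor model (label u) (label v)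
    label-coadj u≢v = trans (complement-adj-≢ u≢v) (cong not (label-adj u≢v))

    module InG  = Realisation G presentTypes false label
                    label-present label-onto label-injective label-adj
    module InGᶜ = Realisation (complement G) presentTypes true label
                    label-present label-onto label-injective label-coadj

    solitary-alone : ∀ c c′ → c′ ≢ c → T (lookup presentTypes c) → T (lookup presentTypes c′) →
                     ¬ T (solitary c)
    solitary-alone c c′ c′≢c c-occurs c′-occurs =
      T-not⁻ (proj₂ (proj₂ (typePair c c′ u≢v off-u off-v tu tv)))
      where
      U = label-onto (inj₂ c) c-occurs
      W = label-onto (inj₂ c′) c′-occurs
      u≢v : proj₁ U ≢ proj₁ W
      u≢v e = c′≢c (inj₂-injective (trans (sym (proj₂ W)) (trans (cong label (sym e)) (proj₂ U))))
      off-u = proj₁ (labelOf-type (position (proj₁ U)) (proj₂ U))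
      tu    = proj₂ (labelOf-type (position (proj₁ U)) (proj₂ U))
      off-v = proj₁ (labelOf-type (position (proj₁ W)) (proj₂ W))
      tv    = proj₂ (labelOf-type (position (proj₁ W)) (proj₂ W))

    conclude : (cert : Certificate) → T (valid presentTypes cert) → NetOr𝓕₁Or𝓕₂ G
    conclude (solitaryClash c) ok = ⊥-elim (solitary-alone c c′ c′≢c c-occurs c′-occurs isSolitary)
      where
      c-occurs = T-∧⁻ˡ (lookup presentTypes c) ok
      isSolitary = T-∧⁻ˡ (solitary c) (T-∧⁻ʳ (lookup presentTypes c) ok)
      other = toWitness {a? = any? (λ c′ → ¬? (c′ ≟ c) ×-dec T? (lookup presentTypes c′))}
                (T-∧⁻ʳ (solitary c) (T-∧⁻ʳ (lookup presentTypes c) ok))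
      c′ = proj₁ other
      c′≢c = proj₁ (proj₂ other)
      c′-occurs = proj₂ (proj₂ other)
    conclude (bullInF₂ p) ok = inj₂ (inj₂ (inj₁ (inj₁ (β , β-inj , β-adj) , InG.modelEmbeds-sound F₂ p ok)))
    conclude (antennaInF₁ q) ok = inj₂ (inj₁ (inj₁
      ( inj₁ (InG.modelInduces-sound antenna q (T-∧⁻ʳ (modelEmbeds presentTypes false F₁ modelInF₁) ok))
      , InG.modelEmbeds-sound F₁ modelInF₁ (T-∧⁻ˡ (modelEmbeds presentTypes false F₁ modelInF₁) ok))))
    conclude (netIso false p r) ok =
      inj₁ (inj₁ (InG.modelIso-sound net p r (T-∧⁻ˡ (modelEmbeds presentTypes false net p) ok)
                                            (T-∧⁻ʳ (modelEmbeds presentTypes false net p) ok)))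
    conclude (netIso true p r) ok =
      inj₁ (inj₂ (InGᶜ.modelIso-sound net p r (T-∧⁻ˡ (modelEmbeds presentTypes true net p) ok)
                                             (T-∧⁻ʳ (modelEmbeds presentTypes true net p) ok)))

    netOr𝓕₁Or𝓕₂ : NetOr𝓕₁Or𝓕₂ G
    netOr𝓕₁Or𝓕₂ = conclude (certificate presentTypes) (certificate-valid presentTypes)

  netOr𝓕₁Or𝓕₂-from-bull : bull ≤ᵢ G → NetOr𝓕₁Or𝓕₂ G
  netOr𝓕₁Or𝓕₂-from-bull (β , β-inj , β-adj) = AroundBull.netOr𝓕₁Or𝓕₂ β β-inj β-adj

mainTheorem7 : (G : Graph) → Free claw G → Free coClaw G →
    (TriangleFree G ⊎ TriangleFree (complement G))
    ⊎ ((G ≅ net ⊎ complement G ≅ net)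
    ⊎ ((In𝓕₁ G ⊎ In𝓕₁ (complement G))
    ⊎ (In𝓕₂ G ⊎ In𝓕₂ (complement G))))
mainTheorem7 G claw-free coClaw-free with triangle? G | triangle? (complement G)
... | inj₁ free | _         = inj₁ (inj₁ free)
... | inj₂ _    | inj₁ free = inj₁ (inj₂ free)
... | inj₂ t    | inj₂ s    = inj₂ (netOr𝓕₁Or𝓕₂-from-bull (bull-from-triangles t s))
  where open ClawFree G claw-free coClaw-free
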